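{- Let $A,B$ be non-empty sets, $I$ a non-empty index set, $\{V_i\}_{i\in I}\subseteq\mathcal{R}(A)$, $\{W_i\}_{i\in I}\subseteq\mathcal{R}(B)$, and let $Z\in\mathcal{R}(A,B)$ be a uniform fuzzy relation. Suppose the system $WL^{2\text{ - }3}(A,B,I,V_i,W_i,Z)$ has a solution that is a uniform fuzzy relation. Then the greatest solution $R$ to $WL^{2\text{ - }3}(A,B,I,V_i,W_i,Z)$ is a uniform fuzzy relation, $E_A^R$ is the greatest solution to $WL^{1\text{ - }4}(A,I,V_i,Z\circ Z^{ -1})$, and $E_B^R$ is the greatest solution to $WL^{1\text{ - }4}(B,I,W_i,Z^{ -1}\circ Z)$.
   Context: $\mathcal{L}=(L,\wedge,\vee,\otimes,\to,0,1)$ is a complete residuated lattice; $x\leftrightarrow y=(x\to y)\wedge(y\to x)$. $\mathcal{R}(X,Y)$: fuzzy relations $X\times Y\to L$ ordered pointwise, $\mathcal{R}(X)=\mathcal{R}(X,X)$; $R^{ -1}(y,x)=R(x,y)$; $(R\circ S)(x,z)=\bigvee_y R(x,y)\otimes S(y,z)$. Kernel and co-kernel of $R\in\mathcal{R}(A,B)$: $E_A^R(a_1,a_2)=\bigwedge_{b}(R(a_1,b)\leftrightarrow R(a_2,b))$, $E_B^R(b_1,b_2)=\bigwedge_a(R(a,b_1)\leftrightarrow R(a,b_2))$. $R$ is a partial fuzzy function if $R(a_1,b)\otimes E_A^R(a_1,a_2)\le R(a_2,b)$, $R(a,b_1)\otimes E_B^R(b_1,b_2)\le R(a,b_2)$ and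 $R(a,b_1)\otimes R(a,b_2)\le E_B^R(b_1,b_2)$; it is a uniform fuzzy relation if moreover each $a$ has some $b$ with $R(a,b)=1$ and each $b$ has some $a$ with $R(a,b)=1$. $WL^{2\text{ - }3}(A,B,I,V_i,W_i,Z)$ (unknown $U\in\mathcal{R}(A,B)$): $U^{ -1}\circ V_i\le W_i\circ U^{ -1}$, $U\circ W_i\le V_i\circ U$ ($i\in I$), $U\le Z$. $WL^{1\text{ - }4}(X,I,T_i,W)$ (unknown $U\in\mathcal{R}(X)$): $U\circ T_i\le T_i\circ U$, $U^{ -1}\circ T_i\le T_i\circ U^{ -1}$ ($i\in I$), $U\le W$, $U^{ -1}\le W$. The greatest solution of a system is the largest solution in the pointwise order. -}

module Defs where

open import Level using (Level; _⊔_) renaming (suc to lsuc)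
open import Data.Product using (Σ; _×_; _,_; ∃)
open import Relation.Binary.PropositionalEquality using (_≡_)

record CRL (c ℓ i : Level) : Set (lsuc (c ⊔ ℓ ⊔ i)) where
  infixr 6 _⊗_
  infixr 5 _⇒_
  infixr 7 _∧_
  infixr 7 _∨_
  infix 4 _≤_
  field
    Carrier : Set c
    _≤_ : Carrier → Carrier → Set ℓ
    ≤-refl : ∀ {x} → x ≤ x
    ≤-trans : ∀ {x y z} → x ≤ y → y ≤ z → x ≤ z
    ≤-antisym : ∀ {x y} → x ≤ y → y ≤ x → x ≡ y
    _∧_ : Carrier → Carrier → Carrier
    _∨_ : Carrier → Carrier → Carrier
    ∧-lb₁ : ∀ x y → x ∧ y ≤ x
    ∧-lb₂ : ∀ x y → x ∧ y ≤ y
    ∧-glb : ∀ {x y z} → z ≤ x → z ≤ y → z ≤ x ∧ y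
    ∨-ub₁ : ∀ x y → x ≤ x ∨ y
    ∨-ub₂ : ∀ x y → y ≤ x ∨ y
    ∨-lub : ∀ {x y z} → x ≤ z → y ≤ z → x ∨ y ≤ z
    ⋀ : {J : Set i} → (J → Carrier) → Carrier
    ⋁ : {J : Set i} → (J → Carrier) → Carrier
    ⋀-lb : ∀ {J : Set i} (f : J → Carrier) (j : J) → ⋀ f ≤ f j
    ⋀-glb : ∀ {J : Set i} (f : J → Carrier) {x} → (∀ j → x ≤ f j) → x ≤ ⋀ f
    ⋁-ub : ∀ {J : Set i} (f : J → Carrier) (j : J) → f j ≤ ⋁ f
    ⋁-lub : ∀ {J : Set i} (f : J → Carrier) {x} → (∀ j → f j ≤ x) → ⋁ f ≤ x
    𝟘 𝟙 : Carrier
    𝟘-least : ∀ x → 𝟘 ≤ x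
    𝟙-greatest : ∀ x → x ≤ 𝟙
    _⊗_ : Carrier → Carrier → Carrier
    ⊗-assoc : ∀ x y z → (x ⊗ y) ⊗ z ≡ x ⊗ (y ⊗ z)
    ⊗-comm : ∀ x y → x ⊗ y ≡ y ⊗ x
    ⊗-identityˡ : ∀ x → 𝟙 ⊗ x ≡ x
    _⇒_ : Carrier → Carrier → Carrier
    adj₁ : ∀ {x y z} → x ⊗ y ≤ z → x ≤ y ⇒ z
    adj₂ : ∀ {x y z} → x ≤ y ⇒ z → x ⊗ y ≤ z

  _⇔_ : Carrier → Carrier → Carrier
  x ⇔ y = (x ⇒ y) ∧ (y ⇒ x)

module FuzzyRelations {c ℓ i : Level} (L : CRL c ℓ i) where
  open CRL L

  FRel : Set i → Set i → Set (i ⊔ c)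
  FRel X Y = X → Y → Carrier

  infix 4 _⊑_
  _⊑_ : {X Y : Set i} → FRel X Y → FRel X Y → Set (i ⊔ ℓ)
  R ⊑ S = ∀ x y → R x y ≤ S x y

  _⁻¹ : {X Y : Set i} → FRel X Y → FRel Y X
  (R ⁻¹) y x = R x y

  infixr 9 _∘_
  _∘_ : {X Y Z : Set i} → FRel X Y → FRel Y Z → FRel X Z
  (R ∘ S) x z = ⋁ (λ y → R x y ⊗ S y z)

  kerA : {A B : Set i} → FRel A B → FRel A A
  kerA R a₁ a₂ = ⋀ (λ b → R a₁ b ⇔ R a₂ b)

  kerB : {A B : Set i} → FRel A B → FRel B B
  kerB R b₁ b₂ = ⋀ (λ a → R a b₁ ⇔ R a b₂)

  IsPartialFuzzyFunction : {A B : Set i} → FRel A B → Set (i ⊔ ℓ)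
  IsPartialFuzzyFunction {A} {B} R =
    (∀ a₁ a₂ b → R a₁ b ⊗ kerA R a₁ a₂ ≤ R a₂ b)
    × (∀ a b₁ b₂ → R a b₁ ⊗ kerB R b₁ b₂ ≤ R a b₂)
    × (∀ a b₁ b₂ → R a b₁ ⊗ R a b₂ ≤ kerB R b₁ b₂)

  IsUniform : {A B : Set i} → FRel A B → Set (i ⊔ c ⊔ ℓ)
  IsUniform {A} {B} R =
    IsPartialFuzzyFunction R
    × (∀ a → Σ B (λ b → R a b ≡ 𝟙))
    × (∀ b → Σ A (λ a → R a b ≡ 𝟙))

  SolWL23 : {A B I : Set i} → (I → FRel A A) → (I → FRel B B) → FRel A B
          → FRel A B → Set (i ⊔ ℓ)
  SolWL23 V W Z U =
    (∀ j → ((U ⁻¹) ∘ V j) ⊑ (W j ∘ (U ⁻¹)))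
    × (∀ j → (U ∘ W j) ⊑ (V j ∘ U))
    × U ⊑ Z

  SolWL14 : {X I : Set i} → (I → FRel X X) → FRel X X → FRel X X → Set (i ⊔ ℓ)
  SolWL14 T W U =
    (∀ j → (U ∘ T j) ⊑ (T j ∘ U))
    × (∀ j → ((U ⁻¹) ∘ T j) ⊑ (T j ∘ (U ⁻¹)))
    × U ⊑ W
    × (U ⁻¹) ⊑ W

  IsGreatest : {X Y : Set i} → (FRel X Y → Set (i ⊔ ℓ)) → FRel X Y → Set (i ⊔ c ⊔ ℓ)
  IsGreatest P R = P R × (∀ S → P S → S ⊑ R)

module Submission where

-- Write  Intertwines V W U  for  U ∘ W j ⊑ V j ∘ U  (all j), and call
-- U  linked  when it intertwines (V, W) and its converse intertwines (W, V).  Both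
-- systems WL^{2-3} and WL^{1-4} say "U is linked and bounded above".  Linkedness is
-- stable under composition and converse, which yields the three facts we need:
--   * (difunctionality) a fuzzy relation is a partial fuzzy function iff
--     R ∘ R⁻¹ ∘ R ⊑ R; if Z is difunctional and R is a solution, then
--     R ∘ R⁻¹ ∘ R is again a solution, hence the greatest solution is difunctional;
--   * (totality) R dominates the given uniform solution, so every row and every
--     column of R contains a 1; together with the above, R is uniform;
--   * (kernel) for total difunctional R we have  kerA R = R ∘ R⁻¹, which is
--     linked; and if S solves WL^{1-4}(V, Z ∘ Z⁻¹) then S ∘ R solves WL^{2-3},
--     so S ⊑ (S ∘ R) ∘ R⁻¹ ⊑ R ∘ R⁻¹ = kerA R.
-- The statement for kerB follows by applying the kernel result to the converse
-- system WL^{2-3}(B, A, W, V, Z⁻¹), whose greatest solution is R⁻¹, since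
-- kerB R is definitionally kerA (R⁻¹).

open import Defs
open import Level using (Level; _⊔_)
open import Data.Product using (Σ; _×_; _,_; proj₁; proj₂)
open import Relation.Binary.PropositionalEquality using (_≡_; refl; sym; trans; cong; subst)
open import Relation.Binary.Bundles using (Preorder)

module Theory {c ℓ i : Level} (L : CRL c ℓ i) where
  open CRL L
  open FuzzyRelations L

  ≤-reflexive : ∀ {x y} → x ≡ y → x ≤ y
  ≤-reflexive refl = ≤-refl

  -- Multiplication is monotone, as a left adjoint.
  ⊗-monoˡ : ∀ {x y z} → x ≤ y → x ⊗ z ≤ y ⊗ z
  ⊗-monoˡ p = adj₂ (≤-trans p (adj₁ ≤-refl))

  ⊗-monoʳ : ∀ {x y z} → x ≤ y → z ⊗ x ≤ z ⊗ y
  ⊗-monoʳ {x} {y} {z} p =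
    ≤-trans (≤-reflexive (⊗-comm z x)) (≤-trans (⊗-monoˡ p) (≤-reflexive (⊗-comm y z)))

  ⊗-mono : ∀ {x y u v} → x ≤ y → u ≤ v → x ⊗ u ≤ y ⊗ v
  ⊗-mono p q = ≤-trans (⊗-monoˡ p) (⊗-monoʳ q)

  ≤-⊗-𝟙 : ∀ {x y} → y ≡ 𝟙 → x ≤ x ⊗ y
  ≤-⊗-𝟙 {x} refl = ≤-reflexive (sym (trans (⊗-comm x 𝟙) (⊗-identityˡ x)))

  ⊗-distribʳ-⋁ : ∀ {J : Set i} (f : J → Carrier) x → ⋁ f ⊗ x ≤ ⋁ (λ j → f j ⊗ x)
  ⊗-distribʳ-⋁ f x = adj₂ (⋁-lub f (λ j → adj₁ (⋁-ub (λ j → f j ⊗ x) j)))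

  ⊗-distribˡ-⋁ : ∀ {J : Set i} (f : J → Carrier) x → x ⊗ ⋁ f ≤ ⋁ (λ j → x ⊗ f j)
  ⊗-distribˡ-⋁ f x =
    ≤-trans (≤-reflexive (⊗-comm x (⋁ f)))
      (≤-trans (⊗-distribʳ-⋁ f x)
        (⋁-lub _ (λ j → ≤-trans (≤-reflexive (⊗-comm (f j) x)) (⋁-ub (λ j → x ⊗ f j) j))))

  infix 4 _≈_
  _≈_ : {X Y : Set i} → FRel X Y → FRel X Y → Set (i ⊔ ℓ)
  R ≈ S = R ⊑ S × S ⊑ R

  ⊑-refl : {X Y : Set i} {R : FRel X Y} → R ⊑ R
  ⊑-refl x y = ≤-refl

  ⊑-trans : {X Y : Set i} {R S T : FRel X Y} → R ⊑ S → S ⊑ T → R ⊑ T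
  ⊑-trans p q x y = ≤-trans (p x y) (q x y)

  ≈-sym : {X Y : Set i} {R S : FRel X Y} → R ≈ S → S ≈ R
  ≈-sym (p , q) = q , p

  ⊑-preorder : (X Y : Set i) → Preorder (i ⊔ c) (i ⊔ ℓ) (i ⊔ ℓ)
  ⊑-preorder X Y = record
    { Carrier = FRel X Y
    ; _≈_ = _≈_
    ; _≲_ = _⊑_
    ; isPreorder = record
      { isEquivalence = record
        { refl = ⊑-refl , ⊑-refl
        ; sym = ≈-sym
        ; trans = λ (p , q) (p' , q') → ⊑-trans p p' , ⊑-trans q' q
        }
      ; reflexive = proj₁
      ; trans = ⊑-trans
      }
    }

  module ⊑-Reasoning {X Y : Set i} where
    open import Relation.Binary.Reasoning.Preorder (⊑-preorder X Y) public

  ⁻¹-mono : {X Y : Set i} {R S : FRel X Y} → R ⊑ S → R ⁻¹ ⊑ S ⁻¹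
  ⁻¹-mono p y x = p x y

  ∘-mono : {X Y Z : Set i} {R R' : FRel X Y} {S S' : FRel Y Z}
    → R ⊑ R' → S ⊑ S' → R ∘ S ⊑ R' ∘ S'
  ∘-mono {R' = R'} {S' = S'} p q x z =
    ⋁-lub _ (λ y → ≤-trans (⊗-mono (p x y) (q y z)) (⋁-ub (λ y → R' x y ⊗ S' y z) y))

  ∘-assoc : {X Y Z U : Set i} (R : FRel X Y) (S : FRel Y Z) (T : FRel Z U)
    → (R ∘ S) ∘ T ≈ R ∘ (S ∘ T)
  ∘-assoc R S T = left , right
    where
    left : (R ∘ S) ∘ T ⊑ R ∘ (S ∘ T)
    left x u = ⋁-lub _ (λ z → ≤-trans (⊗-distribʳ-⋁ (λ y → R x y ⊗ S y z) (T z u))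
      (⋁-lub _ (λ y → ≤-trans (≤-reflexive (⊗-assoc (R x y) (S y z) (T z u)))
        (≤-trans (⊗-monoʳ (⋁-ub (λ z → S y z ⊗ T z u) z))
          (⋁-ub (λ y → R x y ⊗ (S ∘ T) y u) y)))))
    right : R ∘ (S ∘ T) ⊑ (R ∘ S) ∘ T
    right x u = ⋁-lub _ (λ y → ≤-trans (⊗-distribˡ-⋁ (λ z → S y z ⊗ T z u) (R x y))
      (⋁-lub _ (λ z → ≤-trans (≤-reflexive (sym (⊗-assoc (R x y) (S y z) (T z u))))
        (≤-trans (⊗-monoˡ (⋁-ub (λ y → R x y ⊗ S y z) y))
          (⋁-ub (λ z → (R ∘ S) x z ⊗ T z u) z)))))

  ⁻¹-∘ : {X Y Z : Set i} (R : FRel X Y) (S : FRel Y Z) → (R ∘ S) ⁻¹ ≈ S ⁻¹ ∘ R ⁻¹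
  ⁻¹-∘ R S =
    (λ z x → ⋁-lub _ (λ y → ≤-trans (≤-reflexive (⊗-comm (R x y) (S y z)))
      (⋁-ub (λ y → S y z ⊗ R x y) y))) ,
    (λ z x → ⋁-lub _ (λ y → ≤-trans (≤-reflexive (⊗-comm (S y z) (R x y)))
      (⋁-ub (λ y → R x y ⊗ S y z) y)))

  ∘-congʳ : {X Y Z : Set i} {R R' : FRel X Y} {S : FRel Y Z} → R ≈ R' → R ∘ S ≈ R' ∘ S
  ∘-congʳ (p , q) = ∘-mono p ⊑-refl , ∘-mono q ⊑-refl

  -- Kernels.  Note that kerB R is definitionally kerA (R ⁻¹), so every fact about
  -- co-kernels yields one about kernels by passing to the converse.

  kerB-transfer : {A B : Set i} (R : FRel A B) → ∀ a b₁ b₂ → R a b₁ ⊗ kerB R b₁ b₂ ≤ R a b₂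
  kerB-transfer R a b₁ b₂ =
    ≤-trans (≤-reflexive (⊗-comm _ _)) (adj₂ (≤-trans (⋀-lb _ a) (∧-lb₁ _ _)))

  kerA-∘-⊑ : {A B : Set i} (R : FRel A B) → kerA R ∘ R ⊑ R
  kerA-∘-⊑ R a b = ⋁-lub _ (λ a' → adj₂ (≤-trans (⋀-lb _ b) (∧-lb₂ _ _)))

  kerA-sym : {A B : Set i} (R : FRel A B) → kerA R ⁻¹ ≈ kerA R
  kerA-sym R = (λ a₂ a₁ → swap) , (λ a₁ a₂ → swap)
    where
    swap : ∀ {a₁ a₂} → kerA R a₂ a₁ ≤ kerA R a₁ a₂
    swap = ⋀-glb _ (λ b → ≤-trans (⋀-lb _ b) (∧-glb (∧-lb₂ _ _) (∧-lb₁ _ _)))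

  -- Difunctional relations: R ∘ R⁻¹ ∘ R ⊑ R, i.e. for every path a → b' ← a' → b
  -- the degree of the path is at most R a b.
  Difunctional : {A B : Set i} → FRel A B → Set (i ⊔ ℓ)
  Difunctional R = R ∘ (R ⁻¹ ∘ R) ⊑ R

  difunctional-path : {A B : Set i} {R : FRel A B} → Difunctional R
    → ∀ a b' a' b → R a b' ⊗ (R a' b' ⊗ R a' b) ≤ R a b
  difunctional-path {R = R} d a b' a' b =
    ≤-trans (⊗-monoʳ (⋁-ub (λ a'' → R a'' b' ⊗ R a'' b) a'))
      (≤-trans (⋁-ub (λ b'' → R a b'' ⊗ (R ⁻¹ ∘ R) b'' b) b') (d a b))

  difunctional-⁻¹ : {A B : Set i} {R : FRel A B} → Difunctional R → Difunctional (R ⁻¹)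
  difunctional-⁻¹ {R = R} d = begin
    R ⁻¹ ∘ (R ∘ R ⁻¹)       ≈⟨ ∘-assoc (R ⁻¹) R (R ⁻¹) ⟨
    (R ⁻¹ ∘ R) ∘ R ⁻¹       ≈⟨ ∘-congʳ (⁻¹-∘ (R ⁻¹) R) ⟨
    (R ⁻¹ ∘ R) ⁻¹ ∘ R ⁻¹    ≈⟨ ⁻¹-∘ R (R ⁻¹ ∘ R) ⟨
    (R ∘ (R ⁻¹ ∘ R)) ⁻¹     ≲⟨ ⁻¹-mono d ⟩
    R ⁻¹                    ∎
    where open ⊑-Reasoning

  difunctional-kerB : {A B : Set i} {R : FRel A B} → Difunctional R
    → ∀ a b₁ b₂ → R a b₁ ⊗ R a b₂ ≤ kerB R b₁ b₂
  difunctional-kerB {R = R} d a b₁ b₂ = ⋀-glb _ (λ a' → ∧-glb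
    (adj₁ (≤-trans (≤-reflexive (⊗-comm _ _)) (difunctional-path d a' b₁ a b₂)))
    (adj₁ (≤-trans (≤-reflexive (trans (⊗-comm _ _) (cong (R a' b₂ ⊗_) (⊗-comm _ _))))
      (difunctional-path d a' b₂ a b₁))))

  difunctional⇒partial : {A B : Set i} {R : FRel A B} → Difunctional R → IsPartialFuzzyFunction R
  difunctional⇒partial {R = R} d =
    (λ a₁ a₂ b → kerB-transfer (R ⁻¹) b a₁ a₂) , kerB-transfer R , difunctional-kerB d

  partial⇒difunctional : {A B : Set i} {R : FRel A B} → IsPartialFuzzyFunction R → Difunctional R
  partial⇒difunctional {R = R} (_ , _ , bound) a b =
    ⋁-lub _ (λ b' → ≤-trans (⊗-monoʳ (⋁-lub _ (λ a' → bound a' b' b))) (kerB-transfer R a b' b))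

  -- Totality: every row contains an entry equal to 1; Total (R ⁻¹) says the same of
  -- the columns, so IsUniform R is  IsPartialFuzzyFunction R × Total R × Total (R ⁻¹).
  Total : {A B : Set i} → FRel A B → Set (i ⊔ c)
  Total {A} {B} R = ∀ a → Σ B (λ b → R a b ≡ 𝟙)

  total-mono : {A B : Set i} {U R : FRel A B} → U ⊑ R → Total U → Total R
  total-mono {R = R} U⊑R t a with t a
  ... | b , Uab≡𝟙 = b , ≤-antisym (𝟙-greatest _) (subst (λ u → u ≤ R a b) Uab≡𝟙 (U⊑R a b))

  total-detour : {X A B : Set i} {R : FRel A B} → Total R → (S : FRel X A) → S ⊑ (S ∘ R) ∘ R ⁻¹
  total-detour {R = R} t S x a with t a
  ... | b , Rab≡𝟙 =
    ≤-trans (≤-⊗-𝟙 Rab≡𝟙) (≤-trans (≤-⊗-𝟙 Rab≡𝟙)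
      (≤-trans (⊗-monoˡ (⋁-ub (λ a' → S x a' ⊗ R a' b) a))
        (⋁-ub (λ b' → (S ∘ R) x b' ⊗ R a b') b)))

  kerA-≈ : {A B : Set i} {R : FRel A B} → Total R → Difunctional R → kerA R ≈ R ∘ R ⁻¹
  kerA-≈ {R = R} t d =
    ⊑-trans (total-detour t (kerA R)) (∘-mono (kerA-∘-⊑ R) ⊑-refl) ,
    (λ a₁ a₂ → ⋁-lub _ (λ b → difunctional-kerB (difunctional-⁻¹ d) b a₁ a₂))

  -- Intertwining and linked relations.  SolWL23 V W Z U unfolds to
  -- Intertwines W V (U ⁻¹) × Intertwines V W U × U ⊑ Z, and SolWL14 similarly.
  Intertwines : {X Y I : Set i} → (I → FRel X X) → (I → FRel Y Y) → FRel X Y → Set (i ⊔ ℓ)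
  Intertwines V W U = ∀ j → U ∘ W j ⊑ V j ∘ U

  Linked : {X Y I : Set i} → (I → FRel X X) → (I → FRel Y Y) → FRel X Y → Set (i ⊔ ℓ)
  Linked V W U = Intertwines V W U × Intertwines W V (U ⁻¹)

  intertwines-∘ : {X Y Z I : Set i} {V : I → FRel X X} {W : I → FRel Y Y} {T : I → FRel Z Z}
    {U : FRel X Y} {U' : FRel Y Z} → Intertwines V W U → Intertwines W T U' → Intertwines V T (U ∘ U')
  intertwines-∘ {V = V} {W} {T} {U} {U'} h h' j = begin
    (U ∘ U') ∘ T j      ≈⟨ ∘-assoc U U' (T j) ⟩
    U ∘ (U' ∘ T j)      ≲⟨ ∘-mono ⊑-refl (h' j) ⟩
    U ∘ (W j ∘ U')      ≈⟨ ∘-assoc U (W j) U' ⟨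
    (U ∘ W j) ∘ U'      ≲⟨ ∘-mono (h j) ⊑-refl ⟩
    (V j ∘ U) ∘ U'      ≈⟨ ∘-assoc (V j) U U' ⟩
    V j ∘ (U ∘ U')      ∎
    where open ⊑-Reasoning

  intertwines-resp : {X Y I : Set i} {V : I → FRel X X} {W : I → FRel Y Y} {U U' : FRel X Y}
    → U ≈ U' → Intertwines V W U → Intertwines V W U'
  intertwines-resp (U⊑U' , U'⊑U) h j =
    ⊑-trans (∘-mono U'⊑U ⊑-refl) (⊑-trans (h j) (∘-mono ⊑-refl U⊑U'))

  linked-⁻¹ : {X Y I : Set i} {V : I → FRel X X} {W : I → FRel Y Y} {U : FRel X Y}
    → Linked V W U → Linked W V (U ⁻¹)
  linked-⁻¹ (h , h') = h' , h

  linked-∘ : {X Y Z I : Set i} {V : I → FRel X X} {W : I → FRel Y Y} {T : I → FRel Z Z}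
    {U : FRel X Y} {U' : FRel Y Z} → Linked V W U → Linked W T U' → Linked V T (U ∘ U')
  linked-∘ {U = U} {U'} (h₁ , h₂) (h₁' , h₂') =
    intertwines-∘ h₁ h₁' ,
    intertwines-resp (≈-sym (⁻¹-∘ U U')) (intertwines-∘ h₂' h₂)

  linked-resp : {X Y I : Set i} {V : I → FRel X X} {W : I → FRel Y Y} {U U' : FRel X Y}
    → U ≈ U' → Linked V W U → Linked V W U'
  linked-resp (p , q) (h , h') = intertwines-resp (p , q) h , intertwines-resp (⁻¹-mono p , ⁻¹-mono q) h'

  solution-linked : {A B I : Set i} {V : I → FRel A A} {W : I → FRel B B} {Z U : FRel A B}
    → SolWL23 V W Z U → Linked V W U
  solution-linked (s₁ , s₂ , _) = s₂ , s₁

  linked-solution : {A B I : Set i} {V : I → FRel A A} {W : I → FRel B B} {Z U : FRel A B}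
    → Linked V W U → U ⊑ Z → SolWL23 V W Z U
  linked-solution (h , h') U⊑Z = h' , h , U⊑Z

  greatest-⁻¹ : {A B I : Set i} {V : I → FRel A A} {W : I → FRel B B} {Z R : FRel A B}
    → IsGreatest (SolWL23 V W Z) R → IsGreatest (SolWL23 W V (Z ⁻¹)) (R ⁻¹)
  greatest-⁻¹ ((s₁ , s₂ , R⊑Z) , greatest) =
    (s₂ , s₁ , ⁻¹-mono R⊑Z) ,
    (λ S (t₁ , t₂ , S⊑Z⁻¹) → ⁻¹-mono (greatest (S ⁻¹) (t₂ , t₁ , ⁻¹-mono S⊑Z⁻¹)))

  -- If Z is difunctional, so is the greatest solution R: R ∘ R⁻¹ ∘ R is again
  -- linked and lies below Z ∘ Z⁻¹ ∘ Z ⊑ Z.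
  greatest-difunctional : {A B I : Set i} {V : I → FRel A A} {W : I → FRel B B} {Z R : FRel A B}
    → Difunctional Z → IsGreatest (SolWL23 V W Z) R → Difunctional R
  greatest-difunctional {R = R} dZ (solR , greatest) =
    greatest (R ∘ (R ⁻¹ ∘ R)) (linked-solution
      (linked-∘ linkR (linked-∘ (linked-⁻¹ linkR) linkR))
      (⊑-trans (∘-mono R⊑Z (∘-mono (⁻¹-mono R⊑Z) R⊑Z)) dZ))
    where
    linkR = solution-linked solR
    R⊑Z = proj₂ (proj₂ solR)

  kernel-greatest : {A B I : Set i} {V : I → FRel A A} {W : I → FRel B B} {Z R : FRel A B}
    → Difunctional Z → IsGreatest (SolWL23 V W Z) R → Total R
    → IsGreatest (SolWL14 V (Z ∘ Z ⁻¹)) (kerA R)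
  kernel-greatest {V = V} {Z = Z} {R} dZ (solR , greatest) totR =
    (proj₁ linkE , proj₂ linkE , E⊑ZZ⁻¹ , ⊑-trans (proj₁ (kerA-sym R)) E⊑ZZ⁻¹) , maximal
    where
    linkR = solution-linked solR
    R⊑Z = proj₂ (proj₂ solR)
    E≈RR⁻¹ = kerA-≈ totR (greatest-difunctional dZ (solR , greatest))
    linkE : Linked V V (kerA R)
    linkE = linked-resp (≈-sym E≈RR⁻¹) (linked-∘ linkR (linked-⁻¹ linkR))
    E⊑ZZ⁻¹ : kerA R ⊑ Z ∘ Z ⁻¹
    E⊑ZZ⁻¹ = ⊑-trans (proj₁ E≈RR⁻¹) (∘-mono R⊑Z (⁻¹-mono R⊑Z))
    -- A solution S of WL^{1-4} is absorbed by R: S ∘ R solves WL^{2-3}.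
    maximal : ∀ S → SolWL14 V (Z ∘ Z ⁻¹) S → S ⊑ kerA R
    maximal S (t₁ , t₂ , S⊑ZZ⁻¹ , _) =
      ⊑-trans (total-detour totR S) (⊑-trans (∘-mono SR⊑R ⊑-refl) (proj₂ E≈RR⁻¹))
      where
      SR⊑Z : S ∘ R ⊑ Z
      SR⊑Z = ⊑-trans (∘-mono S⊑ZZ⁻¹ R⊑Z) (⊑-trans (proj₁ (∘-assoc Z (Z ⁻¹) Z)) dZ)
      SR⊑R : S ∘ R ⊑ R
      SR⊑R = greatest (S ∘ R) (linked-solution (linked-∘ (t₁ , t₂) linkR) SR⊑Z)

open Theory

theorem7p3 : {c ℓ i : Level} (L : CRL c ℓ i) {A B I : Set i}
    → A → B → I
    → (V : I → FuzzyRelations.FRel L A A) (W : I → FuzzyRelations.FRel L B B)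
    → (Z : FuzzyRelations.FRel L A B)
    → FuzzyRelations.IsUniform L Z
    → Σ (FuzzyRelations.FRel L A B)
        (λ U → FuzzyRelations.SolWL23 L V W Z U × FuzzyRelations.IsUniform L U)
    → (R : FuzzyRelations.FRel L A B)
    → FuzzyRelations.IsGreatest L (FuzzyRelations.SolWL23 L V W Z) R
    → FuzzyRelations.IsUniform L R
      × FuzzyRelations.IsGreatest L
          (FuzzyRelations.SolWL14 L V (FuzzyRelations._∘_ L Z (FuzzyRelations._⁻¹ L Z)))
          (FuzzyRelations.kerA L R)
      × FuzzyRelations.IsGreatest L
          (FuzzyRelations.SolWL14 L W (FuzzyRelations._∘_ L (FuzzyRelations._⁻¹ L Z) Z))
          (FuzzyRelations.kerB L R)
theorem7p3 L _ _ _ _ _ _ (pffZ , _) (U , solU , _ , totU , totU⁻¹) R greatestR =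
  (difunctional⇒partial L dR , totR , totR⁻¹) ,
  kernel-greatest L dZ greatestR totR ,
  kernel-greatest L (difunctional-⁻¹ L dZ) (greatest-⁻¹ L greatestR) totR⁻¹
  where
  U⊑R = proj₂ greatestR U solU
  dZ = partial⇒difunctional L pffZ
  dR = greatest-difunctional L dZ greatestR
  totR = total-mono L U⊑R totU
  totR⁻¹ = total-mono L (λ b a → U⊑R a b) totU⁻¹
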